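{- Let $\phi=\frac{1+\sqrt5}{2}$ and let $(F_n)$ be the Fibonacci numbers, $F_1=F_2=1$, $F_{n+1}=F_n+F_{n-1}$. Then for every integer $n>0$, $$\frac{F_{n+2}-1}{\phi^n}+\frac{F_{n+1}-1}{\phi^{n+1}}=\sum_{i=1}^{n}\frac{1}{\phi^{i}},$$ and moreover $$\lim_{n\to\infty}\left(\frac{F_{n}}{\phi^{n-1}}+\frac{F_{n-1}}{\phi^{n}}\right)=1.$$ -}

module Defs where

open import Data.Nat as ℕ using (ℕ; zero; suc)
open import Data.Integer using (+_)
open import Data.Rational as ℚ using (ℚ; 0ℚ; 1ℚ; ½; -½; _/_)
open import Data.Product using (_×_; ∃-syntax)
open import Data.Sum using (_⊎_)
open import Relation.Binary.PropositionalEquality using (_≡_; refl)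

fib : ℕ → ℕ
fib zero = zero
fib (suc zero) = suc zero
fib (suc (suc n)) = fib (suc n) ℕ.+ fib n

-- The real quadratic field ℚ(√5) ⊂ ℝ : elements re + im·√5 with re, im ∈ ℚ.
-- (ℚ is the normalised rationals, so _≡_ is the correct equality.)
record Q5 : Set where
  constructor _+_√5
  field
    re : ℚ
    im : ℚ
open Q5 public

five : ℚ
five = + 5 / 1

embQ : ℚ → Q5
embQ a = a + 0ℚ √5

embN : ℕ → Q5
embN n = embQ (+ n / 1)

infixl 6 _⊕_ _⊖_
infixl 7 _⊗_

_⊕_ : Q5 → Q5 → Q5
(a + b √5) ⊕ (c + d √5) = (a ℚ.+ c) + (b ℚ.+ d) √5

⊝_ : Q5 → Q5
⊝ (a + b √5) = (ℚ.- a) + (ℚ.- b) √5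

_⊖_ : Q5 → Q5 → Q5
x ⊖ y = x ⊕ (⊝ y)

_⊗_ : Q5 → Q5 → Q5
(a + b √5) ⊗ (c + d √5) = (a ℚ.* c ℚ.+ five ℚ.* (b ℚ.* d)) + (a ℚ.* d ℚ.+ b ℚ.* c) √5

_^_ : Q5 → ℕ → Q5
x ^ zero = embQ 1ℚ
x ^ suc n = x ⊗ (x ^ n)

φ : Q5
φ = ½ + ½ √5

φ⁻¹ : Q5
φ⁻¹ = -½ + ½ √5

φ⊗φ⁻¹ : φ ⊗ φ⁻¹ ≡ embQ 1ℚ
φ⊗φ⁻¹ = refl

φ⁻¹⊗φ : φ⁻¹ ⊗ φ ≡ embQ 1ℚ
φ⁻¹⊗φ = refl

invPow : ℕ → Q5
invPow n = φ⁻¹ ^ n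

sumInvPow : ℕ → Q5
sumInvPow zero = embQ 0ℚ
sumInvPow (suc n) = sumInvPow n ⊕ invPow (suc n)

-- Strict positivity of a + b√5 as a real number (the order induced from ℝ).
Pos : Q5 → Set
Pos (a + b √5) =
    (0ℚ ℚ.≤ a × 0ℚ ℚ.≤ b × (0ℚ ℚ.< a ⊎ 0ℚ ℚ.< b))
  ⊎ (0ℚ ℚ.< a × b ℚ.< 0ℚ × five ℚ.* (b ℚ.* b) ℚ.< a ℚ.* a)
  ⊎ (a ℚ.< 0ℚ × 0ℚ ℚ.< b × a ℚ.* a ℚ.< five ℚ.* (b ℚ.* b))

AbsLt : Q5 → ℚ → Set
AbsLt x ε = Pos (embQ ε ⊖ x) × Pos (embQ ε ⊕ x)

-- Convergence in ℝ of a sequence of elements of ℚ(√5) to L ∈ ℚ(√5)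
-- (rational ε suffice, since ℚ is dense in ℝ).
ConvergesTo : (ℕ → Q5) → Q5 → Set
ConvergesTo s L = ∀ (ε : ℚ) → 0ℚ ℚ.< ε →
  ∃[ N ] (∀ n → N ℕ.≤ n → AbsLt (s n ⊖ L) ε)

-- the sequence n ↦ F_n/φ^{n-1} + F_{n-1}/φ^n, for n ≥ 1 (indexed by n-1 = m)
limSeq : ℕ → Q5
limSeq m = embN (fib (suc m)) ⊗ invPow m ⊕ embN (fib m) ⊗ invPow (suc m)

module Submission where

-- The golden ratio φ and its inverse s = φ⁻¹ = φ - 1 live in the field ℚ(√5),
-- and s is a root of  s + s² = 1.  Everything below is a consequence of that
-- single equation, used through the shift rule  s·p + s·(s·p) = p.
--
-- This gives a ring solver for
--   ℚ(√5), which discharges the purely algebraic rearrangements below.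
-- * For every sequence a with a(m+2) = a(m+1) + a(m) and every root s of
--   s + s² = 1, the weighted sum  a(m+1)·sᵐ + a(m)·sᵐ⁺¹  does not depend on m.
--   For a = F this is the sequence  F_{m+1}/φᵐ + F_m/φᵐ⁺¹  of the theorem, which
--   is therefore constantly 1, so its limit is 1; for a(m) = F_{m+1} it shows
--   F_{n+2}/φⁿ + F_{n+1}/φⁿ⁺¹ = F₂ + F₁/φ = φ.
-- * By the same shift rule, Σ_{i=1}^n φ⁻ⁱ + φ⁻ⁿ + φ⁻⁽ⁿ⁺¹⁾ = φ for every n.
-- Subtracting φ⁻ⁿ + φ⁻⁽ⁿ⁺¹⁾ from the last two identities gives the finite
-- identity of the theorem (which in fact also holds for n = 0).

open import Defs
open import Data.Nat using (ℕ; suc; _>_)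
open import Data.Rational using (1ℚ)
open import Data.Product using (_×_)
open import Relation.Binary.PropositionalEquality using (_≡_)

open import Data.Nat as ℕ using (zero)
open import Data.Integer as ℤ using (+_)
import Data.Integer.Properties as ℤP
open import Data.Rational as ℚ using (ℚ; 0ℚ; mkℚ)
import Data.Rational.Properties as ℚP
open import Data.Nat.Coprimality as Coprimality using (1-coprimeTo)
open import Data.Product using (_,_)
open import Data.Sum using (inj₁)
open import Data.Maybe using (Maybe; just; nothing)
open import Relation.Nullary.Decidable using (yes; dec⇒maybe)
open import Relation.Binary.PropositionalEquality
  using (refl; sym; trans; cong; cong₂; subst; isEquivalence; module ≡-Reasoning)
open import Algebra.Bundles using (CommutativeRing)
open import Algebra.Structures using (IsCommutativeRing)
open import Tactic.RingSolver using (solve-∀)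
open import Tactic.RingSolver.Core.AlmostCommutativeRing
  using (AlmostCommutativeRing; fromCommutativeRing)

open ≡-Reasoning

ℚ-ring : AlmostCommutativeRing _ _
ℚ-ring = fromCommutativeRing ℚP.+-*-commutativeRing (λ x → dec⇒maybe (0ℚ ℚP.≟ x))

module Components where
  open Data.Rational using (_+_; _*_)

  *-assoc-re : ∀ k a b c d e f →
    (a * c + k * (b * d)) * e + k * ((a * d + b * c) * f)
      ≡ a * (c * e + k * (d * f)) + k * (b * (c * f + d * e))
  *-assoc-re = solve-∀ ℚ-ring

  *-assoc-im : ∀ k a b c d e f →
    (a * c + k * (b * d)) * f + (a * d + b * c) * e
      ≡ a * (c * f + d * e) + b * (c * e + k * (d * f))
  *-assoc-im = solve-∀ ℚ-ring

  *-comm-re : ∀ k a b c d → a * c + k * (b * d) ≡ c * a + k * (d * b)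
  *-comm-re = solve-∀ ℚ-ring

  *-comm-im : ∀ a b c d → a * d + b * c ≡ c * b + d * a
  *-comm-im = solve-∀ ℚ-ring

  *-identityˡ-re : ∀ k a b → 1ℚ * a + k * (0ℚ * b) ≡ a
  *-identityˡ-re = solve-∀ ℚ-ring

  *-identityˡ-im : ∀ a b → 1ℚ * b + 0ℚ * a ≡ b
  *-identityˡ-im = solve-∀ ℚ-ring

  *-distribˡ-re : ∀ k a b c d e f →
    a * (c + e) + k * (b * (d + f)) ≡ (a * c + k * (b * d)) + (a * e + k * (b * f))
  *-distribˡ-re = solve-∀ ℚ-ring

  *-distribˡ-im : ∀ a b c d e f →
    a * (d + f) + b * (c + e) ≡ (a * d + b * c) + (a * f + b * e)
  *-distribˡ-im = solve-∀ ℚ-ring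

open Components

zero₅ one₅ : Q5
zero₅ = embQ 0ℚ
one₅ = embQ 1ℚ

⊕-assoc : ∀ x y z → (x ⊕ y) ⊕ z ≡ x ⊕ (y ⊕ z)
⊕-assoc (a + b √5) (c + d √5) (e + f √5) = cong₂ _+_√5 (ℚP.+-assoc a c e) (ℚP.+-assoc b d f)

⊕-comm : ∀ x y → x ⊕ y ≡ y ⊕ x
⊕-comm (a + b √5) (c + d √5) = cong₂ _+_√5 (ℚP.+-comm a c) (ℚP.+-comm b d)

⊕-identityˡ : ∀ x → zero₅ ⊕ x ≡ x
⊕-identityˡ (a + b √5) = cong₂ _+_√5 (ℚP.+-identityˡ a) (ℚP.+-identityˡ b)

⊕-identityʳ : ∀ x → x ⊕ zero₅ ≡ x
⊕-identityʳ (a + b √5) = cong₂ _+_√5 (ℚP.+-identityʳ a) (ℚP.+-identityʳ b)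

⊝-inverseˡ : ∀ x → ⊝ x ⊕ x ≡ zero₅
⊝-inverseˡ (a + b √5) = cong₂ _+_√5 (ℚP.+-inverseˡ a) (ℚP.+-inverseˡ b)

⊝-inverseʳ : ∀ x → x ⊕ ⊝ x ≡ zero₅
⊝-inverseʳ (a + b √5) = cong₂ _+_√5 (ℚP.+-inverseʳ a) (ℚP.+-inverseʳ b)

⊗-assoc : ∀ x y z → (x ⊗ y) ⊗ z ≡ x ⊗ (y ⊗ z)
⊗-assoc (a + b √5) (c + d √5) (e + f √5) =
  cong₂ _+_√5 (*-assoc-re five a b c d e f) (*-assoc-im five a b c d e f)

⊗-comm : ∀ x y → x ⊗ y ≡ y ⊗ x
⊗-comm (a + b √5) (c + d √5) = cong₂ _+_√5 (*-comm-re five a b c d) (*-comm-im a b c d)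

⊗-identityˡ : ∀ x → one₅ ⊗ x ≡ x
⊗-identityˡ (a + b √5) = cong₂ _+_√5 (*-identityˡ-re five a b) (*-identityˡ-im a b)

⊗-identityʳ : ∀ x → x ⊗ one₅ ≡ x
⊗-identityʳ x = trans (⊗-comm x one₅) (⊗-identityˡ x)

⊗-distribˡ : ∀ x y z → x ⊗ (y ⊕ z) ≡ x ⊗ y ⊕ x ⊗ z
⊗-distribˡ (a + b √5) (c + d √5) (e + f √5) =
  cong₂ _+_√5 (*-distribˡ-re five a b c d e f) (*-distribˡ-im a b c d e f)

⊗-distribʳ : ∀ x y z → (y ⊕ z) ⊗ x ≡ y ⊗ x ⊕ z ⊗ x
⊗-distribʳ x y z = begin
  (y ⊕ z) ⊗ x     ≡⟨ ⊗-comm (y ⊕ z) x ⟩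
  x ⊗ (y ⊕ z)     ≡⟨ ⊗-distribˡ x y z ⟩
  x ⊗ y ⊕ x ⊗ z   ≡⟨ cong₂ _⊕_ (⊗-comm x y) (⊗-comm x z) ⟩
  y ⊗ x ⊕ z ⊗ x   ∎

Q5-isCommutativeRing : IsCommutativeRing _≡_ _⊕_ _⊗_ ⊝_ zero₅ one₅
Q5-isCommutativeRing = record
  { isRing = record
    { +-isAbelianGroup = record
      { isGroup = record
        { isMonoid = record
          { isSemigroup = record
            { isMagma = record { isEquivalence = isEquivalence ; ∙-cong = cong₂ _⊕_ }
            ; assoc = ⊕-assoc
            }
          ; identity = ⊕-identityˡ , ⊕-identityʳ
          }
        ; inverse = ⊝-inverseˡ , ⊝-inverseʳ
        ; ⁻¹-cong = cong ⊝_
        }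
      ; comm = ⊕-comm
      }
    ; *-cong = cong₂ _⊗_
    ; *-assoc = ⊗-assoc
    ; *-identity = ⊗-identityˡ , ⊗-identityʳ
    ; distrib = ⊗-distribˡ , ⊗-distribʳ
    }
  ; *-comm = ⊗-comm
  }

Q5-commutativeRing : CommutativeRing _ _
Q5-commutativeRing = record { isCommutativeRing = Q5-isCommutativeRing }

-- The ring solver for ℚ(√5); recognising zero lets it cancel terms such as y - y.
Q5-ring : AlmostCommutativeRing _ _
Q5-ring = fromCommutativeRing Q5-commutativeRing zero₅≟
  where
  zero₅≟ : ∀ x → Maybe (zero₅ ≡ x)
  zero₅≟ (a + b √5) with 0ℚ ℚP.≟ a | 0ℚ ℚP.≟ b
  ... | yes refl | yes refl = just refl
  ... | _        | _        = nothing

embN-+ : ∀ m n → embN (m ℕ.+ n) ≡ embN m ⊕ embN n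
embN-+ m n = cong (_+ 0ℚ √5) (begin
  + (m ℕ.+ n) ℚ./ 1
    ≡⟨ cong (ℚ._/ 1) +[m+n]≡m*1+n*1 ⟩
  (+ m ℤ.* + 1 ℤ.+ + n ℤ.* + 1) ℚ./ 1
    ≡⟨⟩
  mkℚ (+ m) 0 (coprime-to-1 m) ℚ.+ mkℚ (+ n) 0 (coprime-to-1 n)
    ≡⟨ cong₂ ℚ._+_ (sym (k/1≡mkℚ m)) (sym (k/1≡mkℚ n)) ⟩
  + m ℚ./ 1 ℚ.+ + n ℚ./ 1
    ∎)
  where
  coprime-to-1 : ∀ k → Coprimality.Coprime k 1
  coprime-to-1 k = Coprimality.sym (1-coprimeTo k)

  -- k/1 is already in lowest terms.
  k/1≡mkℚ : ∀ k → + k ℚ./ 1 ≡ mkℚ (+ k) 0 (coprime-to-1 k)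
  k/1≡mkℚ k = ℚP.normalize-coprime (coprime-to-1 k)

  +[m+n]≡m*1+n*1 : + (m ℕ.+ n) ≡ + m ℤ.* + 1 ℤ.+ + n ℤ.* + 1
  +[m+n]≡m*1+n*1 = trans (ℤP.pos-+ m n)
    (sym (cong₂ ℤ._+_ (ℤP.*-identityʳ (+ m)) (ℤP.*-identityʳ (+ n))))

φ⁻¹-golden : φ⁻¹ ⊕ φ⁻¹ ⊗ φ⁻¹ ≡ one₅
φ⁻¹-golden = refl

golden-shift : ∀ s → s ⊕ s ⊗ s ≡ one₅ → ∀ p → s ⊗ p ⊕ s ⊗ (s ⊗ p) ≡ p
golden-shift s golden p = begin
  s ⊗ p ⊕ s ⊗ (s ⊗ p)   ≡⟨ factor s p ⟩
  (s ⊕ s ⊗ s) ⊗ p       ≡⟨ cong (_⊗ p) golden ⟩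
  one₅ ⊗ p              ≡⟨ ⊗-identityˡ p ⟩
  p                     ∎
  where
  factor : ∀ s p → s ⊗ p ⊕ s ⊗ (s ⊗ p) ≡ (s ⊕ s ⊗ s) ⊗ p
  factor = solve-∀ Q5-ring

FibonacciLike : (ℕ → Q5) → Set
FibonacciLike a = ∀ m → a (suc (suc m)) ≡ a (suc m) ⊕ a m

fib-FibonacciLike : FibonacciLike (λ m → embN (fib m))
fib-FibonacciLike m = embN-+ (fib (suc m)) (fib m)

weighted : (ℕ → Q5) → Q5 → ℕ → Q5
weighted a s m = a (suc m) ⊗ s ^ m ⊕ a m ⊗ s ^ suc m

-- For a Fibonacci-like a and a root s of s + s² = 1 the weighted sum is invariant
-- under m ↦ m + 1: unfold a(m+2) and apply the shift rule to sᵐ.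
weighted-step : ∀ a s → FibonacciLike a → s ⊕ s ⊗ s ≡ one₅ →
                ∀ m → weighted a s (suc m) ≡ weighted a s m
weighted-step a s recurrence golden m = begin
  a (suc (suc m)) ⊗ sp ⊕ a (suc m) ⊗ (s ⊗ sp)          ≡⟨ cong (λ z → z ⊗ sp ⊕ a (suc m) ⊗ (s ⊗ sp)) (recurrence m) ⟩
  (a (suc m) ⊕ a m) ⊗ sp ⊕ a (suc m) ⊗ (s ⊗ sp)        ≡⟨ regroup (a (suc m)) (a m) sp (s ⊗ sp) ⟩
  a (suc m) ⊗ (sp ⊕ s ⊗ sp) ⊕ a m ⊗ sp                 ≡⟨ cong (λ z → a (suc m) ⊗ z ⊕ a m ⊗ sp) (golden-shift s golden p) ⟩
  a (suc m) ⊗ p ⊕ a m ⊗ sp                             ∎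
  where
  p sp : Q5
  p = s ^ m
  sp = s ⊗ p

  regroup : ∀ x y u v → (x ⊕ y) ⊗ u ⊕ x ⊗ v ≡ x ⊗ (u ⊕ v) ⊕ y ⊗ u
  regroup = solve-∀ Q5-ring

weighted-constant : ∀ a s → FibonacciLike a → s ⊕ s ⊗ s ≡ one₅ →
                    ∀ m → weighted a s m ≡ weighted a s 0
weighted-constant a s recurrence golden zero = refl
weighted-constant a s recurrence golden (suc m) =
  trans (weighted-step a s recurrence golden m) (weighted-constant a s recurrence golden m)

-- F_{m+1}/φᵐ + F_m/φᵐ⁺¹ = F₁ + F₀/φ = 1 for every m.
limSeq-constant : ∀ m → limSeq m ≡ one₅
limSeq-constant = weighted-constant (λ m → embN (fib m)) φ⁻¹ fib-FibonacciLike φ⁻¹-golden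

-- F_{n+2}/φⁿ + F_{n+1}/φⁿ⁺¹ = F₂ + F₁/φ = φ for every n.
shifted-fib-weighted : ∀ n →
  embN (fib (suc (suc n))) ⊗ invPow n ⊕ embN (fib (suc n)) ⊗ invPow (suc n) ≡ φ
shifted-fib-weighted =
  weighted-constant (λ m → embN (fib (suc m))) φ⁻¹ (λ m → fib-FibonacciLike (suc m)) φ⁻¹-golden

-- Σ_{i=1}^n φ⁻ⁱ + φ⁻ⁿ + φ⁻⁽ⁿ⁺¹⁾ = φ: the step n ↦ n + 1 is the shift rule for φ⁻ⁿ.
sumInvPow-closed : ∀ n → sumInvPow n ⊕ invPow n ⊕ invPow (suc n) ≡ φ
sumInvPow-closed zero = refl
sumInvPow-closed (suc n) = begin
  S ⊕ sp ⊕ sp ⊕ φ⁻¹ ⊗ sp          ≡⟨ regroup S sp (φ⁻¹ ⊗ sp) ⟩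
  S ⊕ (sp ⊕ φ⁻¹ ⊗ sp) ⊕ sp        ≡⟨ cong (λ z → S ⊕ z ⊕ sp) (golden-shift φ⁻¹ φ⁻¹-golden p) ⟩
  S ⊕ p ⊕ sp                      ≡⟨ sumInvPow-closed n ⟩
  φ                               ∎
  where
  S p sp : Q5
  S = sumInvPow n
  p = invPow n
  sp = φ⁻¹ ⊗ p

  regroup : ∀ x y z → x ⊕ y ⊕ y ⊕ z ≡ x ⊕ (y ⊕ z) ⊕ y
  regroup = solve-∀ Q5-ring

fibonacci-sum-identity : ∀ n →
  (embN (fib (suc (suc n))) ⊖ embN 1) ⊗ invPow n ⊕ (embN (fib (suc n)) ⊖ embN 1) ⊗ invPow (suc n)
    ≡ sumInvPow n
fibonacci-sum-identity n = begin
  (a ⊖ one₅) ⊗ p ⊕ (b ⊖ one₅) ⊗ q      ≡⟨ subtract-weights a b p q ⟩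
  (a ⊗ p ⊕ b ⊗ q) ⊖ (p ⊕ q)            ≡⟨ cong (_⊖ (p ⊕ q)) (shifted-fib-weighted n) ⟩
  φ ⊖ (p ⊕ q)                          ≡⟨ cong (_⊖ (p ⊕ q)) (sym (sumInvPow-closed n)) ⟩
  (sumInvPow n ⊕ p ⊕ q) ⊖ (p ⊕ q)      ≡⟨ cancel (sumInvPow n) p q ⟩
  sumInvPow n                          ∎
  where
  a b p q : Q5
  a = embN (fib (suc (suc n)))
  b = embN (fib (suc n))
  p = invPow n
  q = invPow (suc n)

  subtract-weights : ∀ a b p q → (a ⊖ one₅) ⊗ p ⊕ (b ⊖ one₅) ⊗ q ≡ (a ⊗ p ⊕ b ⊗ q) ⊖ (p ⊕ q)
  subtract-weights = solve-∀ Q5-ring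

  cancel : ∀ x y z → (x ⊕ y ⊕ z) ⊖ (y ⊕ z) ≡ x
  cancel = solve-∀ Q5-ring

embQ-pos : ∀ {ε} → 0ℚ ℚ.< ε → Pos (embQ ε)
embQ-pos 0<ε = inj₁ (ℚP.<⇒≤ 0<ε , ℚP.≤-refl , inj₁ 0<ε)

absLt-zero : ∀ {ε} → 0ℚ ℚ.< ε → AbsLt zero₅ ε
absLt-zero {ε} 0<ε = pos-after (⊕-identityʳ (embQ ε)) , pos-after (⊕-identityʳ (embQ ε))
  where
  pos-after : ∀ {x} → x ≡ embQ ε → Pos x
  pos-after x≡ε = subst Pos (sym x≡ε) (embQ-pos 0<ε)

constant-converges : ∀ s L → (∀ n → s n ≡ L) → ConvergesTo s L
constant-converges s L s≡L ε 0<ε = 0 , λ n _ →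
  subst (λ x → AbsLt x ε) (sym (trans (cong (_⊖ L) (s≡L n)) (⊝-inverseʳ L))) (absLt-zero 0<ε)

mainTheorem2 : (∀ (n : ℕ) → n > 0 → (embN (fib (suc (suc n))) ⊖ embN 1) ⊗ invPow n ⊕ (embN (fib (suc n)) ⊖ embN 1) ⊗ invPow (suc n) ≡ sumInvPow n)
    × ConvergesTo limSeq (embQ 1ℚ)
mainTheorem2 =
  (λ n _ → fibonacci-sum-identity n) , constant-converges limSeq one₅ limSeq-constant
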